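{- If a graph $G$ is determined by its adjacency spectrum (every graph with the same adjacency characteristic polynomial as $G$ is isomorphic to $G$), then $G$ is determined by its $\mathcal{D}_q$ spectrum (every graph $\mathcal{D}_q$-cospectral with $G$ is isomorphic to $G$).
   Context: The exponential distance matrix $\mathcal{D}_q^G$ of a graph $G$ is indexed by $V(G)$ with $(u,v)$-entry $q^{\mathrm{dist}_G(u,v)}$ if $u,v$ lie in the same component and $0$ otherwise, with $q$ a variable. Graphs are $\mathcal{D}_q$-cospectral if their characteristic polynomials $\det(xI-\mathcal{D}_q)$ agree as polynomials in $x$ and $q$. -}

module Defs where

open import Level using (0ℓ)
open import Data.Nat using (ℕ; zero; suc)
open import Data.Nat.Base using (_%_)
open import Data.Bool using (Bool; true; false; if_then_else_; _∨_; _∧_)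
open import Data.Fin using (Fin; zero; suc; toℕ; punchIn; _≟_)
open import Data.List using (List; []; _∷_; map; allFin; replicate; _++_)
open import Data.Bool.ListAction using (any)
open import Data.Integer using (ℤ; +_)
import Data.Integer as ℤ
open import Relation.Nullary.Decidable using (⌊_⌋)
open import Relation.Binary.PropositionalEquality using (_≡_)
open import Algebra.Bundles.Raw using (RawRing)

-- Polynomials in one variable over a raw ring, as little-endian
-- coefficient lists; equality = equality of all coefficients
-- (so trailing zeros do not matter).

module PolyOps (R : RawRing 0ℓ 0ℓ) where
  open RawRing R

  coeff : List Carrier → ℕ → Carrier
  coeff []      _       = 0#
  coeff (a ∷ p) zero    = a
  coeff (a ∷ p) (suc i) = coeff p i

  addP : List Carrier → List Carrier → List Carrier
  addP []      r       = r
  addP (a ∷ p) []      = a ∷ p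
  addP (a ∷ p) (b ∷ r) = (a + b) ∷ addP p r

  mulP : List Carrier → List Carrier → List Carrier
  mulP []      r = []
  mulP (a ∷ p) r = addP (map (a *_) r) (0# ∷ mulP p r)

polyRing : RawRing 0ℓ 0ℓ → RawRing 0ℓ 0ℓ
polyRing R = record
  { Carrier = List Carrier
  ; _≈_     = λ p r → ∀ i → coeff p i ≈ coeff r i
  ; _+_     = addP
  ; _*_     = mulP
  ; -_      = map -_
  ; 0#      = []
  ; 1#      = 1# ∷ []
  }
  where open RawRing R
        open PolyOps R

-- ℤ[q] (also used as ℤ[x]) and ℤ[q][x] (polynomials in x whose
-- coefficients are polynomials in q).
ℤ[X] : RawRing 0ℓ 0ℓ
ℤ[X] = polyRing ℤ.+-*-rawRing

ℤ[q][x] : RawRing 0ℓ 0ℓ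
ℤ[q][x] = polyRing ℤ[X]

module Det (R : RawRing 0ℓ 0ℓ) where
  open RawRing R

  sumFin : ∀ n → (Fin n → Carrier) → Carrier
  sumFin zero    f = 0#
  sumFin (suc n) f = f zero + sumFin n (λ j → f (suc j))

  sign : ℕ → Carrier
  sign k = if ⌊ Data.Nat._≟_ (k % 2) 0 ⌋ then 1# else - 1#
    where import Data.Nat

  det : ∀ n → (Fin n → Fin n → Carrier) → Carrier
  det zero    M = 1#
  det (suc n) M = sumFin (suc n) λ j →
    sign (toℕ j) * M zero j * det n (λ i k → M (suc i) (punchIn j k))

record Graph (n : ℕ) : Set where
  field
    adj    : Fin n → Fin n → Bool
    sym    : ∀ u v → adj u v ≡ adj v u
    irrefl : ∀ u → adj u u ≡ false
open Graph public

record _≅_ {n m : ℕ} (G : Graph n) (H : Graph m) : Set where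
  field
    to      : Fin n → Fin m
    from    : Fin m → Fin n
    from-to : ∀ u → from (to u) ≡ u
    to-from : ∀ v → to (from v) ≡ v
    pres    : ∀ u v → adj G u v ≡ adj H (to u) (to v)

reach : ∀ {n} → Graph n → ℕ → Fin n → Fin n → Bool
reach {n} G zero    u v = ⌊ u ≟ v ⌋
reach {n} G (suc k) u v =
  reach G k u v ∨ any (λ w → reach G k u w ∧ adj G w v) (allFin n)

qpow : ℕ → List ℤ
qpow k = replicate k (+ 0) ++ (+ 1 ∷ [])

-- expFrom G fuel k u v : q^{dist(u,v)} if k ≤ dist(u,v) < k + fuel
-- (searching the least such length), and 0 otherwise.
expFrom : ∀ {n} → Graph n → ℕ → ℕ → Fin n → Fin n → List ℤ
expFrom G zero       k u v = []
expFrom G (suc fuel) k u v =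
  if reach G k u v then qpow k else expFrom G fuel (suc k) u v

-- Exponential distance matrix D_q: entry q^{dist(u,v)} if u,v are in the
-- same component (then dist(u,v) < n), 0 otherwise.
expDist : ∀ {n} → Graph n → Fin n → Fin n → List ℤ
expDist {n} G u v = expFrom G n 0 u v

adjℤ : ∀ {n} → Graph n → Fin n → Fin n → ℤ
adjℤ G u v = if adj G u v then + 1 else + 0

charPolyA : ∀ {n} → Graph n → List ℤ
charPolyA {n} G = det n (λ u v →
    (if ⌊ u ≟ v ⌋ then (+ 0 ∷ + 1 ∷ []) else []) + - (adjℤ G u v ∷ []))
  where open Det ℤ[X]
        open RawRing ℤ[X]

charPolyD : ∀ {n} → Graph n → List (List ℤ)
charPolyD {n} G = det n (λ u v →
    (if ⌊ u ≟ v ⌋ then ([] ∷ (+ 1 ∷ []) ∷ []) else []) + - (expDist G u v ∷ []))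
  where open Det ℤ[q][x]
        open RawRing ℤ[q][x]

A-cospectral : ∀ {n m} → Graph n → Graph m → Set
A-cospectral G H = RawRing._≈_ ℤ[X] (charPolyA G) (charPolyA H)

Dq-cospectral : ∀ {n m} → Graph n → Graph m → Set
Dq-cospectral G H = RawRing._≈_ ℤ[q][x] (charPolyD G) (charPolyD H)

DAS : ∀ {n} → Graph n → Set
DAS {n} G = ∀ {m} (H : Graph m) → A-cospectral H G → H ≅ G

DDqS : ∀ {n} → Graph n → Set
DDqS {n} G = ∀ {m} (H : Graph m) → Dq-cospectral H G → H ≅ G

-- Evaluating D_q at an integer q gives I + q·R_q, where R_q is an integer matrix congruent to the
-- adjacency matrix A modulo q (off the diagonal R_q(u,v) = q^(dist(u,v) - 1) when u, v are connected,
-- and 0 otherwise).  Hence det((1 + q y) I − D_q) = q^n det(y I − R_q), while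
-- det(y I − R_q) ≡ det(y I − A) (mod q).  For D_q-cospectral H and G the orders agree (at q = 0,
-- D_0 = I and det(3 I − D_0) = 2^n), so det(y I − R_q) agrees for every y and every positive q; thus
-- the values of the two adjacency characteristic polynomials are congruent modulo every positive
-- integer, hence equal, and an integer polynomial is determined by its values at the positive
-- integers.
module Submission where

open import Defs hiding (sym)

open import Level using (0ℓ)
open import Function using (id; _∘_; case_of_)
open import Function.Bundles using (Equivalence)
open import Data.Bool using (Bool; true; false; if_then_else_; _∧_; _∨_)
open import Data.Bool.Properties using (if-float; T-≡)
open import Data.Bool.ListAction using (any)
open import Data.Nat using (ℕ; zero; suc)
import Data.Nat as ℕ
import Data.Nat.Divisibility as ℕ
import Data.Nat.Properties as ℕ
open import Data.Integer as ℤ using (ℤ; +_; _+_; _-_; _*_; -_; _^_; ∣_∣)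
import Data.Integer.Properties as ℤ
open import Data.Integer.Divisibility.Signed
  using (_∣_; divides; ∣⇒∣ᵤ; ∣m∣n⇒∣m+n; ∣m⇒∣-m; ∣m⇒∣m*n; ∣n⇒∣m*n)
open import Data.Integer.Tactic.RingSolver using (solve-∀)
open import Data.Fin using (Fin; zero; suc; toℕ; punchIn; _≟_)
import Data.Fin.Properties as Fin
open import Data.List using (List; []; _∷_; map; drop; allFin)
open import Data.List.Membership.Propositional using (_∈_)
open import Data.List.Membership.Propositional.Properties using (∈-allFin)
import Data.List.Relation.Unary.Any as Any
open import Data.List.Relation.Unary.Any.Properties using (any⁺)
open import Relation.Binary.Core using (Rel)
open import Relation.Binary.Definitions using (Reflexive; tri<; tri≈; tri>)
open import Relation.Binary.PropositionalEquality
open import Relation.Nullary using (¬_; yes; no; contradiction)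
open import Relation.Nullary.Decidable using (⌊_⌋; ⌊⌋-map′; isYes≗does; dec-true; dec-false)
open import Algebra.Bundles using (AbelianGroup)
open import Algebra.Bundles.Raw using (RawRing)
open import Algebra.Definitions using (Congruent₂)
open import Algebra.Morphism.Structures using (IsRingHomomorphism)
import Algebra.Morphism.Construct.Identity as Identity
open import Algebra.Properties.Group (AbelianGroup.group ℤ.+-0-abelianGroup) using (∙-cancelˡ)

infix 4 _≡_mod_

-- A record rather than a synonym for c ∣ a - b, so that a and b stay inferable.
record _≡_mod_ (a b c : ℤ) : Set where
  constructor ≡-mod
  field
    divides-difference : c ∣ a - b

≡-mod-refl : ∀ a c → a ≡ a mod c
≡-mod-refl a c = ≡-mod (divides (+ 0) (trans (ℤ.+-inverseʳ a) (sym (ℤ.*-zeroˡ c))))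

≡-mod-sym : ∀ {a b c} → a ≡ b mod c → b ≡ a mod c
≡-mod-sym {a} {b} (≡-mod c∣a-b) = ≡-mod (subst (_ ∣_) (negate a b) (∣m⇒∣-m c∣a-b))
  where
  negate : ∀ a b → - (a - b) ≡ b - a
  negate = solve-∀

≡-mod-trans : ∀ {a b d c} → a ≡ b mod c → b ≡ d mod c → a ≡ d mod c
≡-mod-trans {a} {b} {d} (≡-mod c∣a-b) (≡-mod c∣b-d) =
  ≡-mod (subst (_ ∣_) (telescope a b d) (∣m∣n⇒∣m+n c∣a-b c∣b-d))
  where
  telescope : ∀ a b d → (a - b) + (b - d) ≡ a - d
  telescope = solve-∀

+-cong-mod : ∀ {a b a′ b′ c} → a ≡ b mod c → a′ ≡ b′ mod c → a + a′ ≡ b + b′ mod c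
+-cong-mod {a} {b} {a′} {b′} (≡-mod p) (≡-mod p′) =
  ≡-mod (subst (_ ∣_) (regroup a b a′ b′) (∣m∣n⇒∣m+n p p′))
  where
  regroup : ∀ a b a′ b′ → (a - b) + (a′ - b′) ≡ (a + a′) - (b + b′)
  regroup = solve-∀

-‿cong-mod : ∀ {a b c} → a ≡ b mod c → - a ≡ - b mod c
-‿cong-mod {a} {b} (≡-mod p) = ≡-mod (subst (_ ∣_) (regroup a b) (∣m⇒∣-m p))
  where
  regroup : ∀ a b → - (a - b) ≡ - a - - b
  regroup = solve-∀

*-cong-mod : ∀ {a b a′ b′ c} → a ≡ b mod c → a′ ≡ b′ mod c → a * a′ ≡ b * b′ mod c
*-cong-mod {a} {b} {a′} {b′} (≡-mod p) (≡-mod p′) =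
  ≡-mod (subst (_ ∣_) (regroup a b a′ b′) (∣m∣n⇒∣m+n (∣m⇒∣m*n a′ p) (∣n⇒∣m*n b p′)))
  where
  regroup : ∀ a b a′ b′ → (a - b) * a′ + b * (a′ - b′) ≡ a * a′ - b * b′
  regroup = solve-∀

≡-mod-of-horner : ∀ a b y P R → a + y * P ≡ b + y * R → a ≡ b mod y
≡-mod-of-horner a b y P R e = ≡-mod (divides (R - P) (begin
  a - b                     ≡⟨ shift a b y P ⟩
  (a + y * P) - (b + y * P) ≡⟨ cong (_- (b + y * P)) e ⟩
  (b + y * R) - (b + y * P) ≡⟨ collect b y P R ⟩
  (R - P) * y               ∎))
  where
  open ≡-Reasoning
  shift : ∀ a b y P → a - b ≡ (a + y * P) - (b + y * P)
  shift = solve-∀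
  collect : ∀ b y P R → (b + y * R) - (b + y * P) ≡ (R - P) * y
  collect = solve-∀

1+n∣n⇒n≡0 : ∀ {n} → suc n ℕ.∣ n → n ≡ 0
1+n∣n⇒n≡0 {zero}  _ = refl
1+n∣n⇒n≡0 {suc n} p = contradiction p (ℕ.>⇒∤ (ℕ.n<1+n (suc n)))

-- Use the modulus ∣a − b∣ + 1, which cannot divide a − b unless a − b = 0.
≡-mod-all⇒≡ : ∀ {a b} → (∀ k → a ≡ b mod + suc k) → a ≡ b
≡-mod-all⇒≡ {a} {b} p = ℤ.i-j≡0⇒i≡j a b (ℤ.∣i∣≡0⇒i≡0 (1+n∣n⇒n≡0 (∣⇒∣ᵤ divides-difference)))
  where open _≡_mod_ (p ∣ a - b ∣)

eval : {A : Set} → (A → ℤ) → ℤ → List A → ℤ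
eval h x []      = + 0
eval h x (a ∷ p) = h a + x * eval h x p

module _ {R : RawRing 0ℓ 0ℓ} {h : RawRing.Carrier R → ℤ}
         (h-hom : IsRingHomomorphism R ℤ.+-*-rawRing h) (x : ℤ) where
  open RawRing R using () renaming (_+_ to _+ᴿ_; _*_ to _*ᴿ_; -_ to -ᴿ_; 0# to 0ᴿ; 1# to 1ᴿ)
  open PolyOps R
  open IsRingHomomorphism h-hom

  eval-+ : ∀ p r → eval h x (addP p r) ≡ eval h x p + eval h x r
  eval-+ []      r       = sym (ℤ.+-identityˡ _)
  eval-+ (a ∷ p) []      = sym (ℤ.+-identityʳ _)
  eval-+ (a ∷ p) (b ∷ r) = begin
    h (a +ᴿ b) + x * eval h x (addP p r)
      ≡⟨ cong₂ (λ s t → s + x * t) (+-homo a b) (eval-+ p r) ⟩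
    (h a + h b) + x * (eval h x p + eval h x r)
      ≡⟨ regroup (h a) (h b) x (eval h x p) (eval h x r) ⟩
    (h a + x * eval h x p) + (h b + x * eval h x r)
      ∎
    where
    open ≡-Reasoning
    regroup : ∀ a b x p r → (a + b) + x * (p + r) ≡ (a + x * p) + (b + x * r)
    regroup = solve-∀

  eval-scale : ∀ a r → eval h x (map (a *ᴿ_) r) ≡ h a * eval h x r
  eval-scale a []      = sym (ℤ.*-zeroʳ (h a))
  eval-scale a (b ∷ r) = begin
    h (a *ᴿ b) + x * eval h x (map (a *ᴿ_) r) ≡⟨ cong₂ (λ s t → s + x * t) (*-homo a b) (eval-scale a r) ⟩
    h a * h b + x * (h a * eval h x r)        ≡⟨ regroup (h a) (h b) x (eval h x r) ⟩
    h a * (h b + x * eval h x r)              ∎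
    where
    open ≡-Reasoning
    regroup : ∀ a b x r → a * b + x * (a * r) ≡ a * (b + x * r)
    regroup = solve-∀

  eval-* : ∀ p r → eval h x (mulP p r) ≡ eval h x p * eval h x r
  eval-* []      r = sym (ℤ.*-zeroˡ (eval h x r))
  eval-* (a ∷ p) r = begin
    eval h x (addP (map (a *ᴿ_) r) (0ᴿ ∷ mulP p r))
      ≡⟨ eval-+ (map (a *ᴿ_) r) (0ᴿ ∷ mulP p r) ⟩
    eval h x (map (a *ᴿ_) r) + (h 0ᴿ + x * eval h x (mulP p r))
      ≡⟨ cong₂ _+_ (eval-scale a r) (cong₂ (λ s t → s + x * t) 0#-homo (eval-* p r)) ⟩
    h a * eval h x r + (+ 0 + x * (eval h x p * eval h x r))
      ≡⟨ regroup (h a) x (eval h x p) (eval h x r) ⟩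
    (h a + x * eval h x p) * eval h x r
      ∎
    where
    open ≡-Reasoning
    regroup : ∀ a x p r → a * r + (+ 0 + x * (p * r)) ≡ (a + x * p) * r
    regroup = solve-∀

  eval-neg : ∀ p → eval h x (map -ᴿ_ p) ≡ - eval h x p
  eval-neg []      = refl
  eval-neg (a ∷ p) = begin
    h (-ᴿ a) + x * eval h x (map -ᴿ_ p) ≡⟨ cong₂ (λ s t → s + x * t) (-‿homo a) (eval-neg p) ⟩
    - h a + x * - eval h x p            ≡⟨ regroup (h a) x (eval h x p) ⟩
    - (h a + x * eval h x p)            ∎
    where
    open ≡-Reasoning
    regroup : ∀ a x p → - a + x * - p ≡ - (a + x * p)
    regroup = solve-∀

  eval-const : ∀ a → eval h x (a ∷ []) ≡ h a
  eval-const a = trans (cong (λ t → h a + t) (ℤ.*-zeroʳ x)) (ℤ.+-identityʳ (h a))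

  eval-X : eval h x (0ᴿ ∷ 1ᴿ ∷ []) ≡ x
  eval-X = begin
    h 0ᴿ + x * eval h x (1ᴿ ∷ []) ≡⟨ cong₂ (λ s t → s + x * t) 0#-homo (trans (eval-const 1ᴿ) 1#-homo) ⟩
    + 0 + x * + 1                 ≡⟨ ℤ.+-identityˡ _ ⟩
    x * + 1                       ≡⟨ ℤ.*-identityʳ x ⟩
    x                             ∎
    where open ≡-Reasoning

  eval-vanishing : ∀ p → (∀ i → h (coeff p i) ≡ + 0) → eval h x p ≡ + 0
  eval-vanishing []      _ = refl
  eval-vanishing (a ∷ p) e =
    trans (cong₂ (λ s t → s + x * t) (e 0) (eval-vanishing p (e ∘ suc)))
          (trans (ℤ.+-identityˡ _) (ℤ.*-zeroʳ x))

  eval-cong : ∀ p r → (∀ i → h (coeff p i) ≡ h (coeff r i)) → eval h x p ≡ eval h x r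
  eval-cong []      r       e = sym (eval-vanishing r (λ i → trans (sym (e i)) 0#-homo))
  eval-cong (a ∷ p) []      e = eval-vanishing (a ∷ p) (λ i → trans (e i) 0#-homo)
  eval-cong (a ∷ p) (b ∷ r) e = cong₂ (λ s t → s + x * t) (e 0) (eval-cong p r (e ∘ suc))

  eval-isRingHomomorphism : IsRingHomomorphism (polyRing R) ℤ.+-*-rawRing (eval h x)
  eval-isRingHomomorphism = record
    { isSemiringHomomorphism = record
      { isNearSemiringHomomorphism = record
        { +-isMonoidHomomorphism = record
          { isMagmaHomomorphism = record
            { isRelHomomorphism = record { cong = λ {p} {r} e → eval-cong p r (⟦⟧-cong ∘ e) }
            ; homo              = eval-+
            }
          ; ε-homo = refl
          }
        ; *-homo = eval-*
        }
      ; 1#-homo = trans (eval-const 1ᴿ) 1#-homo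
      }
    ; -‿homo = eval-neg
    }

id-isRingHomomorphism : IsRingHomomorphism ℤ.+-*-rawRing ℤ.+-*-rawRing id
id-isRingHomomorphism = Identity.isRingHomomorphism ℤ.+-*-rawRing refl

evalℤ : ℤ → List ℤ → ℤ
evalℤ = eval id

evalℤ-isRingHomomorphism : ∀ q → IsRingHomomorphism ℤ[X] ℤ.+-*-rawRing (evalℤ q)
evalℤ-isRingHomomorphism = eval-isRingHomomorphism id-isRingHomomorphism

eval₂ : ℤ → ℤ → List (List ℤ) → ℤ
eval₂ q = eval (evalℤ q)

module _ where
  open PolyOps ℤ.+-*-rawRing using (coeff)

  evalℤ-horner : ∀ y p → evalℤ y p ≡ coeff p 0 + y * evalℤ y (drop 1 p)
  evalℤ-horner y []      = sym (trans (ℤ.+-identityˡ _) (ℤ.*-zeroʳ y))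
  evalℤ-horner y (a ∷ p) = refl

  coeff-suc : ∀ p i → coeff p (suc i) ≡ coeff (drop 1 p) i
  coeff-suc []      i = refl
  coeff-suc (a ∷ p) i = refl

  AgreeOnPositives : List ℤ → List ℤ → Set
  AgreeOnPositives p r = ∀ k → evalℤ (+ suc k) p ≡ evalℤ (+ suc k) r

  module _ (p r : List ℤ) (agree : AgreeOnPositives p r) where

    -- p₀ − r₀ = y (R(y) − P(y)) for the tails P, R, so every positive y divides p₀ − r₀.
    constant-coeffs-agree : coeff p 0 ≡ coeff r 0
    constant-coeffs-agree = ≡-mod-all⇒≡ λ k →
      ≡-mod-of-horner (coeff p 0) (coeff r 0) (+ suc k) (evalℤ (+ suc k) (drop 1 p)) (evalℤ (+ suc k) (drop 1 r))
        (trans (sym (evalℤ-horner (+ suc k) p)) (trans (agree k) (evalℤ-horner (+ suc k) r)))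

    tails-agree : AgreeOnPositives (drop 1 p) (drop 1 r)
    tails-agree k = ℤ.*-cancelˡ-≡ y P R (∙-cancelˡ (coeff p 0) (y * P) (y * R) (begin
      coeff p 0 + y * P ≡⟨ evalℤ-horner y p ⟨
      evalℤ y p         ≡⟨ agree k ⟩
      evalℤ y r         ≡⟨ evalℤ-horner y r ⟩
      coeff r 0 + y * R ≡⟨ cong (_+ y * R) constant-coeffs-agree ⟨
      coeff p 0 + y * R ∎))
      where
      open ≡-Reasoning
      y = + suc k
      P = evalℤ y (drop 1 p)
      R = evalℤ y (drop 1 r)

  coeffs-determined : ∀ p r → AgreeOnPositives p r → ∀ i → coeff p i ≡ coeff r i
  coeffs-determined p r agree zero    = constant-coeffs-agree p r agree
  coeffs-determined p r agree (suc i) = begin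
    coeff p (suc i)    ≡⟨ coeff-suc p i ⟩
    coeff (drop 1 p) i ≡⟨ coeffs-determined (drop 1 p) (drop 1 r) (tails-agree p r agree) i ⟩
    coeff (drop 1 r) i ≡⟨ coeff-suc r i ⟨
    coeff r (suc i)    ∎
    where open ≡-Reasoning

module _ (R : RawRing 0ℓ 0ℓ) where
  open RawRing R using (Carrier) renaming (_+_ to _+ᴿ_; _*_ to _*ᴿ_)
  open Det R

  module _ {ℓ} {_∼_ : Rel Carrier ℓ} (∼-refl : Reflexive _∼_)
           (+-cong : Congruent₂ _∼_ _+ᴿ_) (*-cong : Congruent₂ _∼_ _*ᴿ_) where

    sumFin-resp : ∀ n {f g : Fin n → Carrier} → (∀ j → f j ∼ g j) → sumFin n f ∼ sumFin n g
    sumFin-resp zero    _ = ∼-refl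
    sumFin-resp (suc n) {f} {g} e = +-cong (e zero) (sumFin-resp n {f ∘ suc} {g ∘ suc} (e ∘ suc))

    det-resp : ∀ n {M N : Fin n → Fin n → Carrier} → (∀ i j → M i j ∼ N i j) → det n M ∼ det n N
    det-resp zero    _ = ∼-refl
    det-resp (suc n) {M} {N} e = sumFin-resp (suc n) {term M} {term N} λ j →
      *-cong (*-cong ∼-refl (e zero j)) (det-resp n {minor M j} {minor N j} (λ i k → e (suc i) (punchIn j k)))
      where
      minor : (Fin (suc n) → Fin (suc n) → Carrier) → Fin (suc n) → Fin n → Fin n → Carrier
      minor M j i k = M (suc i) (punchIn j k)
      term : (Fin (suc n) → Fin (suc n) → Carrier) → Fin (suc n) → Carrier
      term M j = sign (toℕ j) *ᴿ M zero j *ᴿ det n (minor M j)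

open Det ℤ.+-*-rawRing using (sumFin; sign; det)

sumFin-cong : ∀ n {f g : Fin n → ℤ} → (∀ j → f j ≡ g j) → sumFin n f ≡ sumFin n g
sumFin-cong = sumFin-resp ℤ.+-*-rawRing {_∼_ = _≡_} refl (cong₂ _+_) (cong₂ _*_)

det-cong : ∀ n {M N : Fin n → Fin n → ℤ} → (∀ i j → M i j ≡ N i j) → det n M ≡ det n N
det-cong = det-resp ℤ.+-*-rawRing {_∼_ = _≡_} refl (cong₂ _+_) (cong₂ _*_)

module _ {R : RawRing 0ℓ 0ℓ} {h : RawRing.Carrier R → ℤ}
         (h-hom : IsRingHomomorphism R ℤ.+-*-rawRing h) where
  open RawRing R using () renaming (_*_ to _*ᴿ_; 1# to 1ᴿ)
  open IsRingHomomorphism h-hom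
  private
    module DetR = Det R

  sumFin-homo : ∀ n f → h (DetR.sumFin n f) ≡ sumFin n (h ∘ f)
  sumFin-homo zero    f = 0#-homo
  sumFin-homo (suc n) f = trans (+-homo _ _) (cong (λ t → h (f zero) + t) (sumFin-homo n (f ∘ suc)))

  sign-homo : ∀ k → h (DetR.sign k) ≡ sign k
  sign-homo k = trans (if-float h b)
    (cong₂ (λ s t → if b then s else t) 1#-homo (trans (-‿homo 1ᴿ) (cong -_ 1#-homo)))
    where b = ⌊ (k ℕ.% 2) ℕ.≟ 0 ⌋

  det-homo : ∀ n M → h (DetR.det n M) ≡ det n (λ i j → h (M i j))
  det-homo zero    M = 1#-homo
  det-homo (suc n) M = trans (sumFin-homo (suc n) term) (sumFin-cong (suc n) term-homo)
    where
    minor : Fin (suc n) → Fin n → Fin n → RawRing.Carrier R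
    minor j i k = M (suc i) (punchIn j k)
    term : Fin (suc n) → RawRing.Carrier R
    term j = DetR.sign (toℕ j) *ᴿ M zero j *ᴿ DetR.det n (minor j)
    term-homo : ∀ j → h (term j) ≡ sign (toℕ j) * h (M zero j) * det n (λ i k → h (minor j i k))
    term-homo j = trans (*-homo _ _) (cong₂ _*_ (trans (*-homo _ _) (cong (_* h (M zero j)) (sign-homo (toℕ j))))
                                                (det-homo n (minor j)))

sumFin-scale : ∀ n c (f : Fin n → ℤ) → sumFin n (λ j → c * f j) ≡ c * sumFin n f
sumFin-scale zero    c f = sym (ℤ.*-zeroʳ c)
sumFin-scale (suc n) c f = trans (cong (λ t → c * f zero + t) (sumFin-scale n c (f ∘ suc)))
                                 (sym (ℤ.*-distribˡ-+ c (f zero) _))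

sumFin-zero : ∀ n → sumFin n (λ _ → + 0) ≡ + 0
sumFin-zero zero    = refl
sumFin-zero (suc n) = trans (ℤ.+-identityˡ _) (sumFin-zero n)

det-scale : ∀ n c (M : Fin n → Fin n → ℤ) → det n (λ i j → c * M i j) ≡ c ^ n * det n M
det-scale zero    c M = refl
det-scale (suc n) c M = begin
  sumFin (suc n) (λ j → sign (toℕ j) * (c * M zero j) * det n (λ i k → c * minor j i k))
    ≡⟨ sumFin-cong (suc n) (λ j → cong (sign (toℕ j) * (c * M zero j) *_) (det-scale n c (minor j))) ⟩
  sumFin (suc n) (λ j → sign (toℕ j) * (c * M zero j) * (c ^ n * det n (minor j)))
    ≡⟨ sumFin-cong (suc n) (λ j → regroup (sign (toℕ j)) c (M zero j) (c ^ n) (det n (minor j))) ⟩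
  sumFin (suc n) (λ j → c * c ^ n * term j)
    ≡⟨ sumFin-scale (suc n) (c * c ^ n) term ⟩
  c * c ^ n * det (suc n) M ∎
  where
  open ≡-Reasoning
  minor : Fin (suc n) → Fin n → Fin n → ℤ
  minor j i k = M (suc i) (punchIn j k)
  term : Fin (suc n) → ℤ
  term j = sign (toℕ j) * M zero j * det n (minor j)
  regroup : ∀ s c m cⁿ d → s * (c * m) * (cⁿ * d) ≡ c * cⁿ * (s * m * d)
  regroup = solve-∀

scalarMatrix : ∀ {n} → ℤ → Fin n → Fin n → ℤ
scalarMatrix x u v = if ⌊ u ≟ v ⌋ then x else + 0

scalarMatrix-suc : ∀ {n} x (u v : Fin n) → scalarMatrix x (suc u) (suc v) ≡ scalarMatrix x u v
scalarMatrix-suc x u v = cong (if_then x else + 0) (⌊⌋-map′ (cong suc) Fin.suc-injective (u ≟ v))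

det-identity : ∀ n → det n (scalarMatrix (+ 1)) ≡ + 1
det-identity zero    = refl
det-identity (suc n) = cong₂ _+_ leading-term other-terms
  where
  minor : Fin n → Fin n → Fin n → ℤ
  minor j i k = scalarMatrix (+ 1) (suc i) (punchIn (suc j) k)
  leading-term : + 1 * + 1 * det n (λ i k → scalarMatrix (+ 1) (suc i) (suc k)) ≡ + 1
  leading-term = trans (ℤ.*-identityˡ _) (trans (det-cong n (scalarMatrix-suc (+ 1))) (det-identity n))
  other-terms : sumFin n (λ j → sign (toℕ (suc j)) * + 0 * det n (minor j)) ≡ + 0
  other-terms = trans (sumFin-cong n (λ j → trans (cong (_* det n (minor j)) (ℤ.*-zeroʳ (sign (toℕ (suc j)))))
                                                  (ℤ.*-zeroˡ (det n (minor j)))))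
                      (sumFin-zero n)

-- charPolyA G and charPolyD G are definitionally the instances R = ℤ, M = adjℤ G and
-- R = ℤ[q], M = expDist G.
charPoly : (R : RawRing 0ℓ 0ℓ) → ∀ n → (Fin n → Fin n → RawRing.Carrier R) → List (RawRing.Carrier R)
charPoly R n M = Det.det (polyRing R) n λ u v → (if ⌊ u ≟ v ⌋ then X else 0ₚ) +ₚ -ₚ (M u v ∷ [])
  where
  open RawRing R using (0#; 1#)
  open RawRing (polyRing R) using () renaming (_+_ to _+ₚ_; -_ to -ₚ_; 0# to 0ₚ)
  X = 0# ∷ 1# ∷ []

module _ {R : RawRing 0ℓ 0ℓ} {h : RawRing.Carrier R → ℤ}
         (h-hom : IsRingHomomorphism R ℤ.+-*-rawRing h) (x : ℤ) where
  open RawRing R using () renaming (0# to 0ᴿ; 1# to 1ᴿ)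
  open RawRing (polyRing R) using () renaming (_+_ to _+ₚ_; -_ to -ₚ_; 0# to 0ₚ)
  open IsRingHomomorphism (eval-isRingHomomorphism h-hom x) using (+-homo; -‿homo)

  eval-charPolyEntry : ∀ b a → eval h x ((if b then 0ᴿ ∷ 1ᴿ ∷ [] else 0ₚ) +ₚ -ₚ (a ∷ []))
                                ≡ (if b then x else + 0) - h a
  eval-charPolyEntry b a = begin
    eval h x (diagonal b +ₚ -ₚ (a ∷ []))
      ≡⟨ +-homo (diagonal b) (-ₚ (a ∷ [])) ⟩
    eval h x (diagonal b) + eval h x (-ₚ (a ∷ []))
      ≡⟨ cong₂ _+_ (eval-diagonal b) (trans (-‿homo (a ∷ [])) (cong -_ (eval-const h-hom x a))) ⟩
    (if b then x else + 0) - h a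
      ∎
    where
    open ≡-Reasoning
    diagonal : Bool → List (RawRing.Carrier R)
    diagonal b = if b then 0ᴿ ∷ 1ᴿ ∷ [] else 0ₚ
    eval-diagonal : ∀ b → eval h x (diagonal b) ≡ (if b then x else + 0)
    eval-diagonal true  = eval-X h-hom x
    eval-diagonal false = refl

  eval-charPoly : ∀ n M → eval h x (charPoly R n M) ≡ det n (λ u v → scalarMatrix x u v - h (M u v))
  eval-charPoly n M = trans (det-homo (eval-isRingHomomorphism h-hom x) n _)
                            (det-cong n (λ u v → eval-charPolyEntry ⌊ u ≟ v ⌋ (M u v)))

any-∈ : {A : Set} (p : A → Bool) {x : A} {xs : List A} → x ∈ xs → p x ≡ true → any p xs ≡ true
any-∈ p x∈xs px = Equivalence.to T-≡ (any⁺ p (Any.map (λ { refl → Equivalence.from T-≡ px }) x∈xs))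

any-false : {A : Set} (p : A → Bool) (xs : List A) → (∀ x → p x ≡ false) → any p xs ≡ false
any-false p []       _  = refl
any-false p (x ∷ xs) px rewrite px x = any-false p xs px

⌊≟⌋-refl : ∀ {n} (u : Fin n) → ⌊ u ≟ u ⌋ ≡ true
⌊≟⌋-refl u = trans (isYes≗does (u ≟ u)) (dec-true (u ≟ u) refl)

⌊≟⌋-≢ : ∀ {n} {u v : Fin n} → ¬ u ≡ v → ⌊ u ≟ v ⌋ ≡ false
⌊≟⌋-≢ {u = u} {v} u≢v = trans (isYes≗does (u ≟ v)) (dec-false (u ≟ v) u≢v)

any-diagonal : ∀ {n} (u : Fin n) (g : Fin n → Bool) → any (λ w → ⌊ u ≟ w ⌋ ∧ g w) (allFin n) ≡ g u
any-diagonal {n} u g with g u in gu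
... | true  = any-∈ (λ w → ⌊ u ≟ w ⌋ ∧ g w) (∈-allFin u) (cong₂ _∧_ (⌊≟⌋-refl u) gu)
... | false = any-false (λ w → ⌊ u ≟ w ⌋ ∧ g w) (allFin n) off-diagonal
  where
  off-diagonal : ∀ w → ⌊ u ≟ w ⌋ ∧ g w ≡ false
  off-diagonal w with u ≟ w
  ... | yes refl = gu
  ... | no _     = refl

reach-1 : ∀ {n} (G : Graph n) {u v : Fin n} → ¬ u ≡ v → reach G 1 u v ≡ adj G u v
reach-1 {n} G {u} {v} u≢v = trans (cong (_∨ any (λ w → ⌊ u ≟ w ⌋ ∧ adj G w v) (allFin n)) (⌊≟⌋-≢ u≢v))
                                  (any-diagonal u (λ w → adj G w v))

evalℤ-qpow : ∀ q k → evalℤ q (qpow k) ≡ q ^ k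
evalℤ-qpow q zero    = cong (λ t → + 1 + t) (ℤ.*-zeroʳ q)
evalℤ-qpow q (suc k) = trans (ℤ.+-identityˡ _) (cong (q *_) (evalℤ-qpow q k))

expFromPred : ∀ {n} → Graph n → ℤ → ℕ → ℕ → Fin n → Fin n → ℤ
expFromPred _ _ zero    _ _ _ = + 0
expFromPred G q (suc f) k u v = if reach G (suc k) u v then q ^ k else expFromPred G q f (suc k) u v

module _ {n} (G : Graph n) (q : ℤ) (u v : Fin n) where

  evalℤ-expFrom-suc : ∀ f k → evalℤ q (expFrom G f (suc k) u v) ≡ q * expFromPred G q f k u v
  evalℤ-expFrom-suc zero    k = sym (ℤ.*-zeroʳ q)
  evalℤ-expFrom-suc (suc f) k with reach G (suc k) u v
  ... | true  = evalℤ-qpow q (suc k)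
  ... | false = evalℤ-expFrom-suc f (suc k)

  expFromPred-far≡0 : ∀ f k → expFromPred G q f (suc k) u v ≡ + 0 mod q
  expFromPred-far≡0 zero    k = ≡-mod-refl (+ 0) q
  expFromPred-far≡0 (suc f) k with reach G (suc (suc k)) u v
  ... | true  = ≡-mod (divides (q ^ k) (trans (ℤ.+-identityʳ _) (ℤ.*-comm q (q ^ k))))
  ... | false = expFromPred-far≡0 f (suc k)

  expFromPred≡adj : ¬ u ≡ v → ∀ f → expFromPred G q (suc f) 0 u v ≡ adjℤ G u v mod q
  expFromPred≡adj u≢v f rewrite reach-1 G u≢v with adj G u v
  ... | true  = ≡-mod-refl (+ 1) q
  ... | false = expFromPred-far≡0 f 0

reducedDist : ∀ {n} → Graph n → ℤ → Fin n → Fin n → ℤ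
reducedDist {suc n} G q u v = if ⌊ u ≟ v ⌋ then + 0 else expFromPred G q n 0 u v

evalℤ-expDist : ∀ {n} (G : Graph n) q u v →
                evalℤ q (expDist G u v) ≡ scalarMatrix (+ 1) u v + q * reducedDist G q u v
evalℤ-expDist {suc n} G q u v with ⌊ u ≟ v ⌋
... | true  = refl
... | false = trans (evalℤ-expFrom-suc G q u v n 0) (sym (ℤ.+-identityˡ _))

adjℤ-irrefl : ∀ {n} (G : Graph n) u → adjℤ G u u ≡ + 0
adjℤ-irrefl G u = cong (if_then + 1 else + 0) (irrefl G u)

reducedDist-diagonal : ∀ {n} (G : Graph n) q u → reducedDist G q u u ≡ + 0
reducedDist-diagonal {suc n} G q u = cong (if_then + 0 else expFromPred G q n 0 u u) (⌊≟⌋-refl u)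

reducedDist-offDiagonal : ∀ {n} (G : Graph n) q {u v} → ¬ u ≡ v → reducedDist G q u v ≡ adjℤ G u v mod q
reducedDist-offDiagonal {1}           G q {zero} {zero} u≢v = contradiction refl u≢v
reducedDist-offDiagonal {suc (suc f)} G q {u}    {v}    u≢v =
  subst (λ b → (if b then + 0 else expFromPred G q (suc f) 0 u v) ≡ adjℤ G u v mod q)
        (sym (⌊≟⌋-≢ u≢v)) (expFromPred≡adj G q u v u≢v f)

reducedDist≡adj : ∀ {n} (G : Graph n) q u v → reducedDist G q u v ≡ adjℤ G u v mod q
reducedDist≡adj G q u v = case u ≟ v of λ where
  (yes refl) → subst₂ (λ r a → r ≡ a mod q) (sym (reducedDist-diagonal G q u)) (sym (adjℤ-irrefl G u))
                      (≡-mod-refl (+ 0) q)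
  (no u≢v)   → reducedDist-offDiagonal G q u≢v

reducedDet : ∀ {n} → Graph n → ℤ → ℤ → ℤ
reducedDet {n} G q y = det n (λ u v → scalarMatrix y u v - reducedDist G q u v)

module _ {n} (G : Graph n) where

  charPolyA-at : ∀ y → evalℤ y (charPolyA G) ≡ det n (λ u v → scalarMatrix y u v - adjℤ G u v)
  charPolyA-at y = eval-charPoly id-isRingHomomorphism y n (adjℤ G)

  charPolyD-at : ∀ q x → eval₂ q x (charPolyD G)
                         ≡ det n (λ u v → scalarMatrix x u v - evalℤ q (expDist G u v))
  charPolyD-at q x = eval-charPoly (evalℤ-isRingHomomorphism q) x n (expDist G)

  charPolyD-at-origin : eval₂ (+ 0) (+ 3) (charPolyD G) ≡ (+ 2) ^ n
  charPolyD-at-origin = begin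
    eval₂ (+ 0) (+ 3) (charPolyD G)
      ≡⟨ charPolyD-at (+ 0) (+ 3) ⟩
    det n (λ u v → scalarMatrix (+ 3) u v - evalℤ (+ 0) (expDist G u v))
      ≡⟨ det-cong n (λ u v → trans (cong (λ t → scalarMatrix (+ 3) u v - t) (evalℤ-expDist G (+ 0) u v))
                                    (entry ⌊ u ≟ v ⌋ (reducedDist G (+ 0) u v))) ⟩
    det n (λ u v → + 2 * scalarMatrix (+ 1) u v)
      ≡⟨ det-scale n (+ 2) (scalarMatrix (+ 1)) ⟩
    (+ 2) ^ n * det n (scalarMatrix (+ 1))
      ≡⟨ cong ((+ 2) ^ n *_) (det-identity n) ⟩
    (+ 2) ^ n * + 1
      ≡⟨ ℤ.*-identityʳ _ ⟩
    (+ 2) ^ n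
      ∎
    where
    open ≡-Reasoning
    entry : ∀ b r → (if b then + 3 else + 0) - ((if b then + 1 else + 0) + + 0 * r) ≡ + 2 * (if b then + 1 else + 0)
    entry true  r = refl
    entry false r = refl

  charPolyD-at-1+qy : ∀ q y → eval₂ q (+ 1 + q * y) (charPolyD G) ≡ q ^ n * reducedDet G q y
  charPolyD-at-1+qy q y = begin
    eval₂ q (+ 1 + q * y) (charPolyD G)
      ≡⟨ charPolyD-at q (+ 1 + q * y) ⟩
    det n (λ u v → scalarMatrix (+ 1 + q * y) u v - evalℤ q (expDist G u v))
      ≡⟨ det-cong n (λ u v → trans (cong (λ t → scalarMatrix (+ 1 + q * y) u v - t) (evalℤ-expDist G q u v))
                                    (entry ⌊ u ≟ v ⌋ (reducedDist G q u v))) ⟩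
    det n (λ u v → q * (scalarMatrix y u v - reducedDist G q u v))
      ≡⟨ det-scale n q _ ⟩
    q ^ n * reducedDet G q y
      ∎
    where
    open ≡-Reasoning
    diagonal : ∀ q y r → (+ 1 + q * y) - (+ 1 + q * r) ≡ q * (y - r)
    diagonal = solve-∀
    off-diagonal : ∀ q r → + 0 - (+ 0 + q * r) ≡ q * (+ 0 - r)
    off-diagonal = solve-∀
    entry : ∀ b r → (if b then + 1 + q * y else + 0) - ((if b then + 1 else + 0) + q * r)
                    ≡ q * ((if b then y else + 0) - r)
    entry true  r = diagonal q y r
    entry false r = off-diagonal q r

  reducedDet≡charPolyA : ∀ q y → reducedDet G q y ≡ evalℤ y (charPolyA G) mod q
  reducedDet≡charPolyA q y = subst (λ c → reducedDet G q y ≡ c mod q) (sym (charPolyA-at y))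
    (det-resp ℤ.+-*-rawRing {_∼_ = λ a b → a ≡ b mod q} (λ {a} → ≡-mod-refl a q) +-cong-mod *-cong-mod
              n {λ u v → scalarMatrix y u v - reducedDist G q u v} {λ u v → scalarMatrix y u v - adjℤ G u v}
              (λ u v → +-cong-mod (≡-mod-refl (scalarMatrix y u v) q) (-‿cong-mod (reducedDist≡adj G q u v))))

abs-^ : ∀ i n → ∣ i ^ n ∣ ≡ ∣ i ∣ ℕ.^ n
abs-^ i zero    = refl
abs-^ i (suc n) = trans (ℤ.abs-* i (i ^ n)) (cong (∣ i ∣ ℕ.*_) (abs-^ i n))

^-injectiveʳ : ∀ b {m n} → 1 ℕ.< b → b ℕ.^ m ≡ b ℕ.^ n → m ≡ n
^-injectiveʳ b {m} {n} 1<b bᵐ≡bⁿ with ℕ.<-cmp m n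
... | tri< m<n _ _ = contradiction bᵐ≡bⁿ (ℕ.<⇒≢ (ℕ.^-monoʳ-< b 1<b m<n))
... | tri≈ _ m≡n _ = m≡n
... | tri> _ _ n<m = contradiction bᵐ≡bⁿ (ℕ.>⇒≢ (ℕ.^-monoʳ-< b 1<b n<m))

^-nonZero : ∀ k n → ℤ.NonZero ((+ suc k) ^ n)
^-nonZero k n = ℤ.≢-nonZero (λ qⁿ≡0 → contradiction (ℤ.i^n≡0⇒i≡0 (+ suc k) n qⁿ≡0) λ ())

module _ {m n} (H : Graph m) (G : Graph n) (cospectral : Dq-cospectral H G) where

  charPolyD-values-agree : ∀ q x → eval₂ q x (charPolyD H) ≡ eval₂ q x (charPolyD G)
  charPolyD-values-agree q x =
    IsRingHomomorphism.⟦⟧-cong (eval-isRingHomomorphism (evalℤ-isRingHomomorphism q) x)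
                               {charPolyD H} {charPolyD G} cospectral

  Dq-cospectral⇒same-order : m ≡ n
  Dq-cospectral⇒same-order = ^-injectiveʳ 2 (ℕ.s≤s (ℕ.s≤s ℕ.z≤n)) (begin
    2 ℕ.^ m                             ≡⟨ abs-^ (+ 2) m ⟨
    ∣ (+ 2) ^ m ∣                       ≡⟨ cong ∣_∣ (charPolyD-at-origin H) ⟨
    ∣ eval₂ (+ 0) (+ 3) (charPolyD H) ∣ ≡⟨ cong ∣_∣ (charPolyD-values-agree (+ 0) (+ 3)) ⟩
    ∣ eval₂ (+ 0) (+ 3) (charPolyD G) ∣ ≡⟨ cong ∣_∣ (charPolyD-at-origin G) ⟩
    ∣ (+ 2) ^ n ∣                       ≡⟨ abs-^ (+ 2) n ⟩
    2 ℕ.^ n                             ∎)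
    where open ≡-Reasoning

module _ {n} (H G : Graph n) (cospectral : Dq-cospectral H G) where

  reducedDets-agree : ∀ k y → reducedDet H (+ suc k) y ≡ reducedDet G (+ suc k) y
  reducedDets-agree k y = ℤ.*-cancelˡ-≡ (q ^ n) _ _ {{^-nonZero k n}} (begin
    q ^ n * reducedDet H q y            ≡⟨ charPolyD-at-1+qy H q y ⟨
    eval₂ q (+ 1 + q * y) (charPolyD H) ≡⟨ charPolyD-values-agree H G cospectral q (+ 1 + q * y) ⟩
    eval₂ q (+ 1 + q * y) (charPolyD G) ≡⟨ charPolyD-at-1+qy G q y ⟩
    q ^ n * reducedDet G q y            ∎)
    where
    open ≡-Reasoning
    q = + suc k

  Dq-cospectral⇒A-cospectral : A-cospectral H G
  Dq-cospectral⇒A-cospectral = coeffs-determined (charPolyA H) (charPolyA G) λ k → ≡-mod-all⇒≡ λ j →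
    ≡-mod-trans (≡-mod-sym (reducedDet≡charPolyA H (+ suc j) (+ suc k)))
                (subst (λ d → d ≡ evalℤ (+ suc k) (charPolyA G) mod + suc j)
                       (sym (reducedDets-agree j (+ suc k)))
                       (reducedDet≡charPolyA G (+ suc j) (+ suc k)))

mainTheorem19 : ∀ {n} (G : Graph n) → DAS G → DDqS G
mainTheorem19 G determined H cospectral with Dq-cospectral⇒same-order H G cospectral
... | refl = determined H (Dq-cospectral⇒A-cospectral H G cospectral)
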